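{- Let $\mathcal{T}$ be a finite set of elements and let $\mathcal{E}$ be a finite set of candidates, each candidate $e$ associated with a nonempty subset $C_e\subseteq\mathcal{T}$. Each candidate $e$ independently chooses a number $r_e$ uniformly at random from $\{1,\dots,N\}$, and condition on the event that all the $r_e$ are pairwise distinct. Each element $t$ lying in some $C_e$ chooses the candidate $e$ with $t\in C_e$ of minimum $r_e$. A candidate $e$ is chosen (added) if at least $|C_e|/8$ elements of $C_e$ choose it. For an element $t$ let $s(t)$ be the number of candidates $e$ with $t\in C_e$. For a candidate $e$, sort $C_e$ by $s(t)$ in non-increasing order and let $T(e)$ be the first $\lceil |C_e|/2\rceil$ elements in this order; call the pair $(e,t)$ good if $t\in T(e)$. If $(e,t)$ is good, then $\Pr[e\text{ is chosen}\mid t\text{ chooses }e]\ge\frac13$.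
   Context: In the paper the elements are uncovered tree edges, candidates are non-tree edges of maximum rounded cost-effectiveness, $C_e$ is the set of uncovered tree edges covered by $e$, and $N=n^8$; iterations with distinct random numbers are called legal. -}

module Defs where

open import Data.Nat using (ℕ; zero; suc; _≤?_; _*_)
open import Data.Fin as F using (Fin; zero; suc)
open import Data.Fin.Subset using (Subset; ∣_∣)
open import Data.Fin.Subset.Properties using (_∈?_)
open import Data.List using (List; []; _∷_; [_]; map; concatMap; allFin; filterᵇ; length; foldr)
open import Data.Bool using (Bool; true; _∧_; _∨_; not)
open import Relation.Nullary.Decidable using (⌊_⌋)

allᵇ : {A : Set} → (A → Bool) → List A → Bool
allᵇ p = foldr (λ x b → p x ∧ b) true

countᵇ : {A : Set} → (A → Bool) → List A → ℕ
countᵇ p xs = length (filterᵇ p xs)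

-- all functions r : Fin m → Fin N (N values; Fin N stands for {1,…,N})
allFuns : (m N : ℕ) → List (Fin m → Fin N)
allFuns zero    N = [ (λ ()) ]
allFuns (suc m) N =
  concatMap (λ f → map (λ x → λ { zero → x ; (suc i) → f i }) (allFin N)) (allFuns m N)

distinct : {m N : ℕ} → (Fin m → Fin N) → Bool
distinct {m} r = allᵇ (λ i → allᵇ (λ j → ⌊ i F.≟ j ⌋ ∨ not ⌊ r i F.≟ r j ⌋) (allFin m)) (allFin m)

-- the legal outcomes: uniform choice conditioned on all r_e distinct
legal : (m N : ℕ) → List (Fin m → Fin N)
legal m N = filterᵇ distinct (allFuns m N)

covers : {k m : ℕ} → (Fin m → Subset k) → Fin m → Fin k → Bool
covers C e t = ⌊ t ∈? C e ⌋

module _ {k m N : ℕ} (C : Fin m → Subset k) where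

  chooses : (Fin m → Fin N) → Fin k → Fin m → Bool
  chooses r t e = covers C e t ∧ allᵇ (λ e' → not (covers C e' t) ∨ ⌊ r e F.≤? r e' ⌋) (allFin m)

  chosen : (Fin m → Fin N) → Fin m → Bool
  chosen r e = ⌊ ∣ C e ∣ ≤? 8 * countᵇ (λ t → chooses r t e) (allFin k) ⌋

s : {k m : ℕ} → (Fin m → Subset k) → Fin k → ℕ
s {m = m} C t = countᵇ (λ e → covers C e t) (allFin m)

{-# OPTIONS --safe #-}
-- Condition on a legal numbering r in which t chooses e, and let t′ ∈ C e with s(t′) ≤ s(t).
-- If t′ does not choose e, it chooses a rival g that covers t′ but not t. For any other
-- candidate h covering t, rotating the numbers of e, g and h (e takes g's, h takes e's and g
-- takes h's) is a bijection of legal numberings after which both t and t′ choose e and h is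
-- the candidate t would choose if e were withdrawn. Since s(t′) ≤ s(t) there are at least as
-- many such h as rivals g, and every numbering has only one such h, so t′ follows t to e with
-- conditional probability at least 1/2.
-- As t lies among the first ⌈|C e|/2⌉ elements, about half of C e comes after t, all with
-- s(t′) ≤ s(t). If e is not chosen, fewer than |C e|/8 elements choose it, so at least three
-- quarters of these later elements defect; averaging this against the bound 1/2 shows that e
-- is not chosen with conditional probability at most 2/3.
module Submission where

open import Defs
open import Data.Nat using (ℕ; zero; suc; _+_; _*_; _≤_; z≤n; s≤s; ⌈_/2⌉; ⌊_/2⌋)
open import Data.Nat.Properties
open import Data.Nat.ListAction using (sum)
open import Data.Nat.Tactic.RingSolver using (solve-∀)
open import Algebra.Properties.CommutativeSemigroup +-commutativeSemigroup using (interchange)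
open import Data.Bool using (Bool; true; false; T; _∧_; _∨_; not)
open import Data.Bool.Properties using (T-∧; T-≡; T?)
open import Data.Empty using (⊥; ⊥-elim)
open import Data.Unit using (tt)
open import Data.Product using (Σ; _×_; _,_; proj₁; proj₂)
open import Data.Sum as Sum using (_⊎_; inj₁; inj₂)
open import Data.Fin as F using (Fin; zero; suc)
import Data.Fin.Properties as F
open import Data.Fin.Subset using (Subset; Nonempty; ∣_∣; inside; outside) renaming (_∈_ to _∈ₛ_; ⊥ to ∅)
open import Data.Fin.Subset.Properties using (_∈?_; ∉⊥)
open import Data.Fin.Permutation using (Permutation′; _⟨$⟩ʳ_; _⟨$⟩ˡ_; inverseʳ; transpose; _∘ₚ_)
import Data.Fin.Permutation.Components as PC
open import Data.Vec using ([]; _∷_)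
open import Data.List using (List; []; _∷_; length; map; concatMap; tabulate; allFin; filterᵇ; take; drop; _++_)
open import Data.List.Properties using (take++drop≡id; length-take; length-++; map-tabulate)
open import Data.List.Membership.Propositional using (_∈_)
open import Data.List.Membership.Propositional.Properties
  using (∈-allFin; ∈-map⁺; ∈-map⁻; ∈-concat⁺′; ∈-filter⁺; ∈-filter⁻; ∈-++⁺ˡ; ∈-++⁺ʳ)
open import Data.List.Relation.Unary.Any using (here; there)
open import Data.List.Relation.Unary.All as All using (All; []; _∷_)
open import Data.List.Relation.Unary.AllPairs as AllPairs using (AllPairs; []; _∷_)
import Data.List.Relation.Unary.AllPairs.Properties as AllPairs
open import Data.List.Relation.Unary.Unique.Propositional using (Unique)
import Data.List.Relation.Unary.Unique.Propositional.Properties as Unique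
open import Data.List.Relation.Unary.Linked using (Linked)
open import Data.List.Relation.Unary.Linked.Properties using (Linked⇒AllPairs)
open import Function using (_∘_)
open import Function.Bundles using (_⇔_; mk⇔; Equivalence; Injection)
open import Function.Definitions using (Injective)
open import Function.Properties.Inverse using (↔⇒↣)
open import Relation.Nullary using (¬_; Dec; yes; no)
open import Relation.Nullary.Decidable
  using (⌊_⌋; toWitness; fromWitness; toWitnessFalse; fromWitnessFalse; dec-true; dec-false; ⌊⌋-map′)
open import Relation.Binary.PropositionalEquality
  using (_≡_; _≢_; refl; sym; trans; cong; cong₂; subst; _≗_; module ≡-Reasoning)

open Equivalence using (to; from)

𝟙 : Bool → ℕ
𝟙 true  = 1
𝟙 false = 0

∑ : {A : Set} → List A → (A → ℕ) → ℕ
∑ xs f = sum (map f xs)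

module _ {A : Set} where

  countᵇ≡∑𝟙 : (p : A → Bool) (xs : List A) → countᵇ p xs ≡ ∑ xs (λ x → 𝟙 (p x))
  countᵇ≡∑𝟙 p [] = refl
  countᵇ≡∑𝟙 p (x ∷ xs) with p x
  ... | true  = cong suc (countᵇ≡∑𝟙 p xs)
  ... | false = countᵇ≡∑𝟙 p xs

  ∑-mono-≤ : (xs : List A) {f g : A → ℕ} → (∀ x → x ∈ xs → f x ≤ g x) → ∑ xs f ≤ ∑ xs g
  ∑-mono-≤ []       f≤g = z≤n
  ∑-mono-≤ (x ∷ xs) f≤g = +-mono-≤ (f≤g x (here refl)) (∑-mono-≤ xs (λ y y∈ → f≤g y (there y∈)))

  ∑-cong : (xs : List A) {f g : A → ℕ} → (∀ x → f x ≡ g x) → ∑ xs f ≡ ∑ xs g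
  ∑-cong []       f≡g = refl
  ∑-cong (x ∷ xs) f≡g = cong₂ _+_ (f≡g x) (∑-cong xs f≡g)

  ∑-+ : (xs : List A) (f g : A → ℕ) → ∑ xs (λ x → f x + g x) ≡ ∑ xs f + ∑ xs g
  ∑-+ []       f g = refl
  ∑-+ (x ∷ xs) f g = trans (cong (f x + g x +_) (∑-+ xs f g)) (interchange (f x) (g x) (∑ xs f) (∑ xs g))

  ∑-*ˡ : (xs : List A) (c : ℕ) (f : A → ℕ) → ∑ xs (λ x → c * f x) ≡ c * ∑ xs f
  ∑-*ˡ []       c f = sym (*-zeroʳ c)
  ∑-*ˡ (x ∷ xs) c f = trans (cong (c * f x +_) (∑-*ˡ xs c f)) (sym (*-distribˡ-+ c (f x) (∑ xs f)))

  ∑-const : (xs : List A) (c : ℕ) → ∑ xs (λ _ → c) ≡ length xs * c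
  ∑-const []       c = refl
  ∑-const (x ∷ xs) c = cong (c +_) (∑-const xs c)

  ∑-one : (xs : List A) → ∑ xs (λ _ → 1) ≡ length xs
  ∑-one xs = trans (∑-const xs 1) (*-identityʳ (length xs))

  ∈⇒≤∑ : (xs : List A) (f : A → ℕ) {x : A} → x ∈ xs → f x ≤ ∑ xs f
  ∈⇒≤∑ (y ∷ xs) f (here refl) = m≤m+n (f y) (∑ xs f)
  ∈⇒≤∑ (y ∷ xs) f (there x∈) = ≤-trans (∈⇒≤∑ xs f x∈) (m≤n+m (∑ xs f) (f y))

  ∑-longer-≥ : {B : Set} (xs : List A) (ys : List B) (f : A → ℕ) (g : B → ℕ) → length xs ≤ length ys →
               (∀ {x y} → x ∈ xs → y ∈ ys → f x ≤ g y) → ∑ xs f ≤ ∑ ys g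
  ∑-longer-≥ []       ys       f g _         _   = z≤n
  ∑-longer-≥ (x ∷ xs) (y ∷ ys) f g (s≤s len) f≤g =
    +-mono-≤ (f≤g (here refl) (here refl)) (∑-longer-≥ xs ys f g len (λ x∈ y∈ → f≤g (there x∈) (there y∈)))

∑-comm : {A B : Set} (xs : List A) (ys : List B) (f : A → B → ℕ) →
         ∑ xs (λ x → ∑ ys (f x)) ≡ ∑ ys (λ y → ∑ xs (λ x → f x y))
∑-comm xs []       f = trans (∑-const xs 0) (*-zeroʳ (length xs))
∑-comm xs (y ∷ ys) f = trans (∑-+ xs (λ x → f x y) (λ x → ∑ ys (f x))) (cong (∑ xs (λ x → f x y) +_) (∑-comm xs ys f))

𝟙-mono : ∀ {a b} → (T a → T b) → 𝟙 a ≤ 𝟙 b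
𝟙-mono {false}         _   = z≤n
𝟙-mono {true}  {true}  _   = ≤-refl
𝟙-mono {true}  {false} a⇒b = ⊥-elim (a⇒b _)

𝟙-T : ∀ {a} → T a → 𝟙 a ≡ 1
𝟙-T {true} _ = refl

𝟙-≤ : ∀ {a n} → (T a → 1 ≤ n) → 𝟙 a ≤ n
𝟙-≤ {false} _     = z≤n
𝟙-≤ {true}  a⇒1≤n = a⇒1≤n _

*-𝟙-≤ : ∀ {a} c n → (T a → c ≤ n) → c * 𝟙 a ≤ n
*-𝟙-≤ {false} c n _     = ≤-trans (≤-reflexive (*-zeroʳ c)) z≤n
*-𝟙-≤ {true}  c n a⇒c≤n = ≤-trans (≤-reflexive (*-identityʳ c)) (a⇒c≤n _)

𝟙-disjoint-+ : ∀ {a b c} → (T a → T c) → (T b → T c) → (T a → T b → ⊥) → 𝟙 a + 𝟙 b ≤ 𝟙 c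
𝟙-disjoint-+ {false} {b}     _   b⇒c _      = 𝟙-mono b⇒c
𝟙-disjoint-+ {true}  {false} a⇒c _   _      = ≤-trans (≤-reflexive (+-identityʳ 1)) (𝟙-mono a⇒c)
𝟙-disjoint-+ {true}  {true}  _   _   ¬a∧b   = ⊥-elim (¬a∧b _ _)

𝟙-cover-+ : ∀ {a b c} → (T c → T a ⊎ T b) → 𝟙 c ≤ 𝟙 a + 𝟙 b
𝟙-cover-+ {a} {b} {false} _ = z≤n
𝟙-cover-+ {a} {b} {true}  c⇒a⊎b with c⇒a⊎b _
... | inj₁ Ta = ≤-trans (≤-reflexive (sym (𝟙-T Ta))) (m≤m+n (𝟙 a) (𝟙 b))
... | inj₂ Tb = ≤-trans (≤-reflexive (sym (𝟙-T Tb))) (m≤n+m (𝟙 b) (𝟙 a))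

module _ {A : Set} where

  countᵇ-mono : (p q : A → Bool) (xs : List A) → (∀ x → x ∈ xs → T (p x) → T (q x)) →
                countᵇ p xs ≤ countᵇ q xs
  countᵇ-mono p q xs p⇒q = begin
    countᵇ p xs            ≡⟨ countᵇ≡∑𝟙 p xs ⟩
    ∑ xs (λ x → 𝟙 (p x))   ≤⟨ ∑-mono-≤ xs (λ x x∈ → 𝟙-mono (p⇒q x x∈)) ⟩
    ∑ xs (λ x → 𝟙 (q x))   ≡⟨ countᵇ≡∑𝟙 q xs ⟨
    countᵇ q xs            ∎
    where open ≤-Reasoning

  countᵇ-none : (p : A → Bool) (xs : List A) → (∀ x → x ∈ xs → ¬ T (p x)) → countᵇ p xs ≡ 0
  countᵇ-none p []       _  = refl
  countᵇ-none p (x ∷ xs) ¬p with p x in px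
  ... | false = countᵇ-none p xs (λ y y∈ → ¬p y (there y∈))
  ... | true  = ⊥-elim (¬p x (here refl) (from T-≡ px))

  countᵇ-≤1 : {D : A → A → Set} (p : A → Bool) (xs : List A) → AllPairs D xs →
              (∀ {a b} → D a b → T (p a) → T (p b) → ⊥) → countᵇ p xs ≤ 1
  countᵇ-≤1 p [] _ _ = z≤n
  countᵇ-≤1 p (x ∷ xs) (Dx ∷ Dxs) not-both with p x in px
  ... | false = countᵇ-≤1 p xs Dxs not-both
  ... | true  = s≤s (≤-reflexive (countᵇ-none p xs (λ y y∈ → not-both (All.lookup Dx y∈) (from T-≡ px))))

  countᵇ-split : (p q : A → Bool) (xs : List A) →
                 countᵇ p xs ≡ countᵇ (λ x → p x ∧ q x) xs + countᵇ (λ x → p x ∧ not (q x)) xs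
  countᵇ-split p q [] = refl
  countᵇ-split p q (x ∷ xs) with p x | q x
  ... | false | _     = countᵇ-split p q xs
  ... | true  | true  = cong suc (countᵇ-split p q xs)
  ... | true  | false = trans (cong suc (countᵇ-split p q xs)) (sym (+-suc _ _))

  countᵇ-cong : {p q : A → Bool} (xs : List A) → (∀ x → p x ≡ q x) → countᵇ p xs ≡ countᵇ q xs
  countᵇ-cong {p} {q} xs p≡q = begin
    countᵇ p xs           ≡⟨ countᵇ≡∑𝟙 p xs ⟩
    ∑ xs (λ x → 𝟙 (p x))  ≡⟨ ∑-cong xs (λ x → cong 𝟙 (p≡q x)) ⟩
    ∑ xs (λ x → 𝟙 (q x))  ≡⟨ countᵇ≡∑𝟙 q xs ⟨
    countᵇ q xs           ∎
    where open ≡-Reasoning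

  countᵇ-map : {B : Set} (p : B → Bool) (f : A → B) (xs : List A) → countᵇ p (map f xs) ≡ countᵇ (λ x → p (f x)) xs
  countᵇ-map p f []       = refl
  countᵇ-map p f (x ∷ xs) with p (f x)
  ... | true  = cong suc (countᵇ-map p f xs)
  ... | false = countᵇ-map p f xs

  countᵇ-∷ : (p : A → Bool) (xs : List A) {x : A} → T (p x) → countᵇ p (x ∷ xs) ≡ suc (countᵇ p xs)
  countᵇ-∷ p xs {x} px with p x
  ... | true = refl

  countᵇ-true : (xs : List A) → countᵇ (λ _ → true) xs ≡ length xs
  countᵇ-true []       = refl
  countᵇ-true (x ∷ xs) = cong suc (countᵇ-true xs)

  countᵇ-≤-𝟙 : {D : A → A → Set} (p : A → Bool) (xs : List A) {b : Bool} → AllPairs D xs →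
               (∀ {a a′} → D a a′ → T (p a) → T (p a′) → ⊥) → (∀ x → T (p x) → T b) → countᵇ p xs ≤ 𝟙 b
  countᵇ-≤-𝟙 p xs {true}  apart not-both _   = countᵇ-≤1 p xs apart not-both
  countᵇ-≤-𝟙 p xs {false} _     _        p⇒b = ≤-reflexive (countᵇ-none p xs (λ x _ → p⇒b x))

∑-countᵇ-comm : {A B : Set} (q : B → A → Bool) (xs : List A) (ys : List B) →
                ∑ xs (λ x → countᵇ (λ y → q y x) ys) ≡ ∑ ys (λ y → countᵇ (q y) xs)
∑-countᵇ-comm q xs ys = begin
  ∑ xs (λ x → countᵇ (λ y → q y x) ys)  ≡⟨ ∑-cong xs (λ x → countᵇ≡∑𝟙 (λ y → q y x) ys) ⟩
  ∑ xs (λ x → ∑ ys (λ y → 𝟙 (q y x)))   ≡⟨ ∑-comm xs ys (λ x y → 𝟙 (q y x)) ⟩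
  ∑ ys (λ y → ∑ xs (λ x → 𝟙 (q y x)))   ≡⟨ ∑-cong ys (λ y → countᵇ≡∑𝟙 (q y) xs) ⟨
  ∑ ys (λ y → countᵇ (q y) xs)          ∎
  where open ≡-Reasoning

module _ {A B : Set} (p : A → Bool) (q : B → A → Bool) (xs : List A) (ys : List B) where

  countᵇ-≤-∑ : (∀ x → x ∈ xs → T (p x) → Σ B (λ y → y ∈ ys × T (q y x))) →
               countᵇ p xs ≤ ∑ ys (λ y → countᵇ (q y) xs)
  countᵇ-≤-∑ witness = begin
    countᵇ p xs                           ≡⟨ countᵇ≡∑𝟙 p xs ⟩
    ∑ xs (λ x → 𝟙 (p x))                  ≤⟨ ∑-mono-≤ xs hit ⟩
    ∑ xs (λ x → countᵇ (λ y → q y x) ys)  ≡⟨ ∑-countᵇ-comm q xs ys ⟩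
    ∑ ys (λ y → countᵇ (q y) xs)          ∎
    where
    open ≤-Reasoning
    hit : ∀ x → x ∈ xs → 𝟙 (p x) ≤ countᵇ (λ y → q y x) ys
    hit x x∈ = 𝟙-≤ λ px → let y , y∈ , qyx = witness x x∈ px in begin
      1                              ≡⟨ 𝟙-T qyx ⟨
      𝟙 (q y x)                      ≤⟨ ∈⇒≤∑ ys (λ y → 𝟙 (q y x)) y∈ ⟩
      ∑ ys (λ y → 𝟙 (q y x))         ≡⟨ countᵇ≡∑𝟙 (λ y → q y x) ys ⟨
      countᵇ (λ y → q y x) ys        ∎

  ∑-countᵇ-≤ : {D : B → B → Set} → AllPairs D ys →
               (∀ x → x ∈ xs → ∀ {y y′} → D y y′ → T (q y x) → T (q y′ x) → ⊥) →
               (∀ x y → T (q y x) → T (p x)) → ∑ ys (λ y → countᵇ (q y) xs) ≤ countᵇ p xs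
  ∑-countᵇ-≤ apart not-both q⇒p = begin
    ∑ ys (λ y → countᵇ (q y) xs)          ≡⟨ ∑-countᵇ-comm q xs ys ⟨
    ∑ xs (λ x → countᵇ (λ y → q y x) ys)  ≤⟨ ∑-mono-≤ xs (λ x x∈ → countᵇ-≤-𝟙 (λ y → q y x) ys apart
                                                (not-both x x∈) (λ y → q⇒p x y)) ⟩
    ∑ xs (λ x → 𝟙 (p x))                  ≡⟨ countᵇ≡∑𝟙 p xs ⟨
    countᵇ p xs                           ∎
    where open ≤-Reasoning

length-≤-by-injective-relation : {A B : Set} (R : A → B → Set) → (∀ a b → Dec (R a b)) →
  (D : A → A → Set) (xs : List A) (ys : List B) → AllPairs D xs →
  (∀ {a a′ b} → D a a′ → R a b → R a′ b → ⊥) →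
  (∀ {a} → a ∈ xs → Σ B (λ b → b ∈ ys × R a b)) → length xs ≤ length ys
length-≤-by-injective-relation {A} {B} R R? D xs ys apart injective total = begin
  length xs                                 ≡⟨ countᵇ-true xs ⟨
  countᵇ (λ _ → true) xs                    ≤⟨ countᵇ-≤-∑ (λ _ → true) related xs ys
                                                 (λ a a∈ _ → let b , b∈ , Rab = total a∈ in b , b∈ , fromWitness Rab) ⟩
  ∑ ys (λ b → countᵇ (λ a → related b a) xs) ≤⟨ ∑-mono-≤ ys (λ b _ → countᵇ-≤1 (related b) xs apart
                                                 (λ d Rab Ra′b → injective d (toWitness Rab) (toWitness Ra′b))) ⟩
  ∑ ys (λ _ → 1)                            ≡⟨ ∑-one ys ⟩
  length ys                                 ∎
  where
  open ≤-Reasoning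
  related : B → A → Bool
  related b a = ⌊ R? a b ⌋

Unique⇒length-≤ : {A : Set} (_≟_ : (a b : A) → Dec (a ≡ b)) {xs ys : List A} → Unique xs →
  (∀ {x} → x ∈ xs → x ∈ ys) → length xs ≤ length ys
Unique⇒length-≤ _≟_ {xs} {ys} uniq xs⊆ys =
  length-≤-by-injective-relation _≡_ _≟_ _≢_ xs ys uniq (λ x≢y x≡z y≡z → x≢y (trans x≡z (sym y≡z)))
    (λ {x} x∈ → x , xs⊆ys x∈ , refl)

Unique⇒countᵇ-≤ : {A : Set} (_≟_ : (a b : A) → Dec (a ≡ b)) (p : A → Bool) {xs ys : List A} → Unique xs →
  (∀ {x} → x ∈ xs → x ∈ ys) → countᵇ p xs ≤ countᵇ p ys
Unique⇒countᵇ-≤ _≟_ p {xs} uniq xs⊆ys = Unique⇒length-≤ _≟_ (Unique.filter⁺ (T? ∘ p) uniq)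
  λ x∈ → let x∈xs , px = ∈-filter⁻ (T? ∘ p) {xs = xs} x∈ in ∈-filter⁺ (T? ∘ p) (xs⊆ys x∈xs) px

T-⌊⌋∨not⌊⌋ : {P Q : Set} {P? : Dec P} {Q? : Dec Q} → T (⌊ P? ⌋ ∨ not ⌊ Q? ⌋) ⇔ (Q → P)
T-⌊⌋∨not⌊⌋ {P? = yes p}               = mk⇔ (λ _ _ → p) (λ _ → tt)
T-⌊⌋∨not⌊⌋ {P? = no ¬p} {Q? = yes q} = mk⇔ (λ ()) (λ q⇒p → ¬p (q⇒p q))
T-⌊⌋∨not⌊⌋ {P? = no ¬p} {Q? = no ¬q} = mk⇔ (λ _ q → ⊥-elim (¬q q)) (λ _ → tt)

T-not⌊⌋∨⌊⌋ : {P Q : Set} {P? : Dec P} {Q? : Dec Q} → T (not ⌊ P? ⌋ ∨ ⌊ Q? ⌋) ⇔ (P → Q)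
T-not⌊⌋∨⌊⌋ {P? = no ¬p}               = mk⇔ (λ _ p → ⊥-elim (¬p p)) (λ _ → tt)
T-not⌊⌋∨⌊⌋ {P? = yes p} {Q? = yes q} = mk⇔ (λ _ _ → q) (λ _ → tt)
T-not⌊⌋∨⌊⌋ {P? = yes p} {Q? = no ¬q} = mk⇔ (λ ()) (λ p⇒q → ¬q (p⇒q p))

T-not : ∀ {b} → T (not b) ⇔ (¬ T b)
T-not {false} = mk⇔ (λ _ ()) (λ _ → tt)
T-not {true}  = mk⇔ (λ ()) (λ ¬b → ¬b tt)

T-⌊⌋ : {P : Set} {P? : Dec P} → T ⌊ P? ⌋ ⇔ P
T-⌊⌋ = mk⇔ toWitness fromWitness

T-allᵇ : {A : Set} (p : A → Bool) (xs : List A) → T (allᵇ p xs) ⇔ (∀ x → x ∈ xs → T (p x))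
T-allᵇ p xs = mk⇔ (all⇒ xs) (⇒all xs)
  where
  all⇒ : ∀ xs → T (allᵇ p xs) → ∀ x → x ∈ xs → T (p x)
  all⇒ (y ∷ xs) px∧ x (here refl) = proj₁ (to T-∧ px∧)
  all⇒ (y ∷ xs) px∧ x (there x∈) = all⇒ xs (proj₂ (to T-∧ px∧)) x x∈
  ⇒all : ∀ xs → (∀ x → x ∈ xs → T (p x)) → T (allᵇ p xs)
  ⇒all []       _   = tt
  ⇒all (y ∷ xs) all = from T-∧ (all y (here refl) , ⇒all xs (λ x x∈ → all x (there x∈)))

T-allᵇ-allFin : ∀ {n} (p : Fin n → Bool) → T (allᵇ p (allFin n)) ⇔ (∀ i → T (p i))
T-allᵇ-allFin {n} p = mk⇔ (λ all i → to (T-allᵇ p (allFin n)) all i (∈-allFin i))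
                          (λ all → from (T-allᵇ p (allFin n)) (λ i _ → all i))

allᵇ-cong : {A : Set} {p q : A → Bool} (xs : List A) → (∀ x → p x ≡ q x) → allᵇ p xs ≡ allᵇ q xs
allᵇ-cong []       p≡q = refl
allᵇ-cong (x ∷ xs) p≡q = cong₂ _∧_ (p≡q x) (allᵇ-cong xs p≡q)

T-distinct : ∀ {m N} (r : Fin m → Fin N) → T (distinct r) ⇔ Injective _≡_ _≡_ r
T-distinct {m} r = mk⇔
  (λ d {i} {j} → to (T-⌊⌋∨not⌊⌋ {P? = i F.≟ j}) (to (T-allᵇ-allFin (row i)) (to rows d i) j))
  (λ inj → from rows (λ i → from (T-allᵇ-allFin (row i)) (λ j → from (T-⌊⌋∨not⌊⌋ {P? = i F.≟ j}) inj)))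
  where
  row : Fin m → Fin m → Bool
  row i j = ⌊ i F.≟ j ⌋ ∨ not ⌊ r i F.≟ r j ⌋
  rows : T (distinct r) ⇔ (∀ i → T (allᵇ (row i) (allFin m)))
  rows = T-allᵇ-allFin (λ i → allᵇ (row i) (allFin m))

-- Legal numberings

_≉_ : ∀ {m N} → (Fin m → Fin N) → (Fin m → Fin N) → Set
r ≉ r′ = ¬ r ≗ r′

allFuns-complete : ∀ m N (r : Fin m → Fin N) → Σ (Fin m → Fin N) (λ r′ → r′ ∈ allFuns m N × r ≗ r′)
allFuns-complete zero    N r = _ , here refl , λ ()
allFuns-complete (suc m) N r with allFuns-complete m N (r ∘ F.suc)
... | r′ , r′∈ , r∘suc≗r′ =
  _ , ∈-concat⁺′ (∈-map⁺ _ (∈-allFin (r zero))) (∈-map⁺ _ r′∈) , λ { zero → refl ; (suc i) → r∘suc≗r′ i }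

module _ {m N : ℕ} (extend : (Fin m → Fin N) → Fin N → Fin (suc m) → Fin N)
  (extend-zero : ∀ r x → extend r x zero ≡ x) (extend-suc : ∀ r x i → extend r x (suc i) ≡ r i) where

  private
    block : (Fin m → Fin N) → List (Fin (suc m) → Fin N)
    block r = map (extend r) (allFin N)

    block-unique : ∀ r → AllPairs _≉_ (block r)
    block-unique r = AllPairs.map⁺ (AllPairs.map
      (λ {x} {y} x≢y a≗b → x≢y (trans (sym (extend-zero r x)) (trans (a≗b zero) (extend-zero r y))))
      (Unique.allFin⁺ N))

    blocks-apart : ∀ {r r′} → r ≉ r′ → All (λ a → All (λ b → a ≉ b) (block r′)) (block r)
    blocks-apart {r} {r′} r≉r′ = All.tabulate λ a∈ → All.tabulate λ b∈ → apart (∈-map⁻ _ a∈) (∈-map⁻ _ b∈)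
      where
      apart : ∀ {a b} → Σ _ (λ x → x ∈ allFin N × a ≡ extend r x) → Σ _ (λ y → y ∈ allFin N × b ≡ extend r′ y) → a ≉ b
      apart (x , _ , refl) (y , _ , refl) a≗b =
        r≉r′ λ i → trans (sym (extend-suc r x i)) (trans (a≗b (suc i)) (extend-suc r′ y i))

  extensions-unique : ∀ {rs} → AllPairs _≉_ rs → AllPairs _≉_ (concatMap block rs)
  extensions-unique {rs} rs-unique = AllPairs.concat⁺ (All.tabulate (λ {bs} bs∈ → unique-∈ bs∈))
    (AllPairs.map⁺ (AllPairs.map blocks-apart rs-unique))
    where
    unique-∈ : ∀ {bs} → bs ∈ map block rs → AllPairs _≉_ bs
    unique-∈ bs∈ with ∈-map⁻ _ bs∈
    ... | r , _ , refl = block-unique r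

allFuns-unique : ∀ m N → AllPairs _≉_ (allFuns m N)
allFuns-unique zero    N = All.[] ∷ []
allFuns-unique (suc m) N = extensions-unique _ (λ _ _ → refl) (λ _ _ _ → refl) (allFuns-unique m N)

module _ {m N : ℕ} where

  ∈-legal⁻ : {r : Fin m → Fin N} → r ∈ legal m N → Injective _≡_ _≡_ r
  ∈-legal⁻ {r} r∈ = to (T-distinct r) (proj₂ (∈-filter⁻ (T? ∘ distinct) {xs = allFuns m N} r∈))

  legal-complete : (r : Fin m → Fin N) → Injective _≡_ _≡_ r → Σ (Fin m → Fin N) (λ r′ → r′ ∈ legal m N × r ≗ r′)
  legal-complete r r-inj with allFuns-complete m N r
  ... | r′ , r′∈ , r≗r′ = r′ , ∈-filter⁺ (T? ∘ distinct) r′∈ (from (T-distinct r′) r′-inj) , r≗r′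
    where
    r′-inj : Injective _≡_ _≡_ r′
    r′-inj {i} {j} eq = r-inj (trans (r≗r′ i) (trans eq (sym (r≗r′ j))))

  legal-unique : AllPairs _≉_ (legal m N)
  legal-unique = AllPairs.filter⁺ (T? ∘ distinct) (allFuns-unique m N)

  Respects≗ : ((Fin m → Fin N) → Bool) → Set
  Respects≗ Q = ∀ {r r′} → r ≗ r′ → Q r ≡ Q r′

  countᵇ-legal-∘-≤ : (π : Permutation′ m) (Q : (Fin m → Fin N) → Bool) → Respects≗ Q →
    countᵇ (λ r → Q (r ∘ (π ⟨$⟩ʳ_))) (legal m N) ≤ countᵇ Q (legal m N)
  countᵇ-legal-∘-≤ π Q Q-resp = length-≤-by-injective-relation
    (λ r r′ → r ∘ (π ⟨$⟩ʳ_) ≗ r′) (λ r r′ → F.all? (λ i → r (π ⟨$⟩ʳ i) F.≟ r′ i)) _≉_ _ _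
    (AllPairs.filter⁺ _ legal-unique) injective total
    where
    injective : ∀ {r r′ r″} → r ≉ r′ → r ∘ (π ⟨$⟩ʳ_) ≗ r″ → r′ ∘ (π ⟨$⟩ʳ_) ≗ r″ → ⊥
    injective {r} {r′} r≉r′ rπ≗r″ r′π≗r″ = r≉r′ λ i → begin
      r i                              ≡⟨ cong r (inverseʳ π) ⟨
      r (π ⟨$⟩ʳ (π ⟨$⟩ˡ i))             ≡⟨ rπ≗r″ (π ⟨$⟩ˡ i) ⟩
      _                                ≡⟨ r′π≗r″ (π ⟨$⟩ˡ i) ⟨
      r′ (π ⟨$⟩ʳ (π ⟨$⟩ˡ i))            ≡⟨ cong r′ (inverseʳ π) ⟩
      r′ i                             ∎
      where open ≡-Reasoning
    total : ∀ {r} → r ∈ filterᵇ (λ r → Q (r ∘ (π ⟨$⟩ʳ_))) (legal m N) →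
            Σ _ (λ r′ → r′ ∈ filterᵇ Q (legal m N) × r ∘ (π ⟨$⟩ʳ_) ≗ r′)
    total {r} r∈ with ∈-filter⁻ (T? ∘ (λ r → Q (r ∘ (π ⟨$⟩ʳ_)))) r∈
    ... | r∈legal , Qrπ with legal-complete (r ∘ (π ⟨$⟩ʳ_)) (Injection.injective (↔⇒↣ π) ∘ ∈-legal⁻ r∈legal)
    ... | r′ , r′∈ , rπ≗r′ = r′ , ∈-filter⁺ (T? ∘ Q) r′∈ (subst T (Q-resp rπ≗r′) Qrπ) , rπ≗r′

-- Three-cycles

module _ {n : ℕ} where

  transpose-matchˡ : (i j : Fin n) → PC.transpose i j i ≡ j
  transpose-matchˡ i j rewrite dec-true (i F.≟ i) refl = refl

  transpose-matchʳ : (i j : Fin n) → PC.transpose i j j ≡ i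
  transpose-matchʳ i j with j F.≟ i
  ... | yes refl = refl
  ... | no  j≢i rewrite dec-true (j F.≟ j) refl = refl

  transpose-mismatch : {i j k : Fin n} → k ≢ i → k ≢ j → PC.transpose i j k ≡ k
  transpose-mismatch {i} {j} {k} k≢i k≢j rewrite dec-false (k F.≟ i) k≢i | dec-false (k F.≟ j) k≢j = refl

  cycle : Fin n → Fin n → Fin n → Permutation′ n
  cycle a b c = transpose b c ∘ₚ transpose a b

  module _ {a b c : Fin n} (a≢b : a ≢ b) (b≢c : b ≢ c) (c≢a : c ≢ a) where

    cycle-a : cycle a b c ⟨$⟩ʳ a ≡ b
    cycle-a rewrite transpose-mismatch {k = a} a≢b (c≢a ∘ sym) = transpose-matchˡ a b

    cycle-c : cycle a b c ⟨$⟩ʳ c ≡ a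
    cycle-c rewrite transpose-matchʳ b c = transpose-matchʳ a b

    cycle-b : cycle a b c ⟨$⟩ʳ b ≡ c
    cycle-b rewrite transpose-matchˡ b c = transpose-mismatch c≢a (b≢c ∘ sym)

    cycle-other : ∀ {z} → z ≢ a → z ≢ b → z ≢ c → cycle a b c ⟨$⟩ʳ z ≡ z
    cycle-other z≢a z≢b z≢c rewrite transpose-mismatch z≢b z≢c = transpose-mismatch z≢a z≢b

    cycle-≢a : ∀ {z} → z ≢ a → (cycle a b c ⟨$⟩ʳ z ≡ c ⊎ cycle a b c ⟨$⟩ʳ z ≡ a) ⊎ cycle a b c ⟨$⟩ʳ z ≡ z
    cycle-≢a {z} z≢a = by-cases (z F.≟ b) (z F.≟ c)
      where
      ρ : Fin n → Fin n
      ρ = cycle a b c ⟨$⟩ʳ_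
      by-cases : Dec (z ≡ b) → Dec (z ≡ c) → (ρ z ≡ c ⊎ ρ z ≡ a) ⊎ ρ z ≡ z
      by-cases (yes z≡b) _         = inj₁ (inj₁ (trans (cong ρ z≡b) cycle-b))
      by-cases (no _)    (yes z≡c) = inj₁ (inj₂ (trans (cong ρ z≡c) cycle-c))
      by-cases (no z≢b)  (no z≢c)  = inj₂ (cycle-other z≢a z≢b z≢c)

module _ {k m : ℕ} (C : Fin m → Subset k) where

  T-chooses : ∀ {N} (r : Fin m → Fin N) t e →
    T (chooses C r t e) ⇔ (t ∈ₛ C e × (∀ e′ → t ∈ₛ C e′ → r e F.≤ r e′))
  T-chooses r t e = mk⇔
    (λ ch → let t∈e , minimal = to (T-∧ {covers C e t}) ch in
            to T-⌊⌋ t∈e , λ e′ → to (T-not⌊⌋∨⌊⌋ {P? = t ∈? C e′}) (to (T-allᵇ-allFin beaten) minimal e′))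
    (λ (t∈e , minimal) → from (T-∧ {covers C e t})
      (from T-⌊⌋ t∈e , from (T-allᵇ-allFin beaten) (λ e′ → from (T-not⌊⌋∨⌊⌋ {P? = t ∈? C e′}) (minimal e′))))
    where
    beaten : Fin m → Bool
    beaten e′ = not (covers C e′ t) ∨ ⌊ r e F.≤? r e′ ⌋

  chooses-resp : ∀ {N} {r r′ : Fin m → Fin N} t e → r ≗ r′ → chooses C r t e ≡ chooses C r′ t e
  chooses-resp t e r≗r′ = cong (covers C e t ∧_) (allᵇ-cong (allFin m) λ e′ →
    cong (not (covers C e′ t) ∨_) (cong₂ (λ x y → ⌊ x F.≤? y ⌋) (r≗r′ e) (r≗r′ e′)))

  chooses-unique : ∀ {N} {r : Fin m → Fin N} {t e e′} → Injective _≡_ _≡_ r →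
    T (chooses C r t e) → T (chooses C r t e′) → e ≡ e′
  chooses-unique {r = r} {t} {e} {e′} r-inj ch ch′ =
    let t∈e , e-min = to (T-chooses r t e) ch
        t∈e′ , e′-min = to (T-chooses r t e′) ch′
    in r-inj (F.≤-antisym (e-min e′ t∈e′) (e′-min e t∈e))

  chooses-exists : ∀ {N} (r : Fin m → Fin N) {t e} → t ∈ₛ C e → Σ (Fin m) (λ g → T (chooses C r t g))
  chooses-exists {N} r {t} {e} t∈e = g , from (T-chooses r t g) (t∈g , g-min)
    where
    open import Data.List.Extrema (F.≤-totalOrder N) using (argmin; argmin-all; f[argmin]≤f[xs])
    covering : List (Fin m)
    covering = filterᵇ (λ e′ → covers C e′ t) (allFin m)
    ∈-covering⁺ : ∀ e′ → t ∈ₛ C e′ → e′ ∈ covering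
    ∈-covering⁺ e′ t∈e′ = ∈-filter⁺ (T? ∘ (λ e′ → covers C e′ t)) (∈-allFin e′) (from T-⌊⌋ t∈e′)
    ∈-covering⁻ : ∀ {e′} → e′ ∈ covering → t ∈ₛ C e′
    ∈-covering⁻ e′∈ = to T-⌊⌋ (proj₂ (∈-filter⁻ (T? ∘ (λ e′ → covers C e′ t)) {xs = allFin m} e′∈))
    g : Fin m
    g = argmin r e covering
    t∈g : t ∈ₛ C g
    t∈g = argmin-all r {xs = covering} t∈e (All.tabulate ∈-covering⁻)
    g-min : ∀ e′ → t ∈ₛ C e′ → r g F.≤ r e′
    g-min e′ t∈e′ = All.lookup (f[argmin]≤f[xs] e covering) (∈-covering⁺ e′ t∈e′)

withdraw : ∀ {k m} → Fin m → (Fin m → Subset k) → Fin m → Subset k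
withdraw e C e′ with e′ F.≟ e
... | yes _ = ∅
... | no  _ = C e′

∈-withdraw : ∀ {k m} {C : Fin m → Subset k} {e e′ t} → t ∈ₛ withdraw e C e′ ⇔ (e′ ≢ e × t ∈ₛ C e′)
∈-withdraw {e = e} {e′} with e′ F.≟ e
... | yes refl = mk⇔ (⊥-elim ∘ ∉⊥) (λ (e≢e , _) → ⊥-elim (e≢e refl))
... | no  e′≢e = mk⇔ (e′≢e ,_) proj₂

∈-withdraw-⊎ : ∀ {k m} {C : Fin m → Subset k} {e e′ t} → t ∈ₛ C e′ → t ∈ₛ withdraw e C e′ ⊎ e′ ≡ e
∈-withdraw-⊎ {e = e} {e′} t∈e′ with e′ F.≟ e
... | yes e′≡e = inj₂ e′≡e
... | no  _    = inj₁ t∈e′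

-- Following t to e

module _ {k m N : ℕ} (C : Fin m → Subset k) (e : Fin m) {t t′ : Fin k}
         (t∈e : t ∈ₛ C e) (t′∈e : t′ ∈ₛ C e) (s[t′]≤s[t] : s C t′ ≤ s C t) where

  private
    L : List (Fin m → Fin N)
    L = legal m N

    t→e t′→e : (Fin m → Fin N) → Bool
    t→e  r = chooses C r t e
    t′→e r = chooses C r t′ e

    rival other : Fin m → Bool
    rival g = covers C g t′ ∧ not (covers C g t)
    other h = covers (withdraw e C) h t

    rivals others : List (Fin m)
    rivals = filterᵇ rival (allFin m)
    others = filterᵇ other (allFin m)

    T-rival : ∀ g → T (rival g) ⇔ (t′ ∈ₛ C g × ¬ t ∈ₛ C g)
    T-rival g = mk⇔ (λ x → let a , b = to (T-∧ {covers C g t′}) x in toWitness a , toWitnessFalse b)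
                    (λ (a , b) → from (T-∧ {covers C g t′}) (fromWitness a , fromWitnessFalse b))

    is-e : Fin m → ℕ
    is-e g = 𝟙 ⌊ g F.≟ e ⌋

    rival-or-e⇒covers-t′ : ∀ g → 𝟙 (rival g) + is-e g ≤ 𝟙 (covers C g t′)
    rival-or-e⇒covers-t′ g = 𝟙-disjoint-+
      (from T-⌊⌋ ∘ proj₁ ∘ to (T-rival g))
      (λ g≡e → from T-⌊⌋ (subst (λ g → t′ ∈ₛ C g) (sym (toWitness g≡e)) t′∈e))
      (λ rival-g g≡e → proj₂ (to (T-rival g) rival-g) (subst (λ g → t ∈ₛ C g) (sym (toWitness g≡e)) t∈e))

    covers-t⇒other-or-e : ∀ g → 𝟙 (covers C g t) ≤ 𝟙 (other g) + is-e g
    covers-t⇒other-or-e g = 𝟙-cover-+ {other g} λ t∈g →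
      Sum.map (from T-⌊⌋) (fromWitness {a? = g F.≟ e}) (∈-withdraw-⊎ {C = C} (to T-⌊⌋ t∈g))

  rivals≤others : length rivals ≤ length others
  rivals≤others = +-cancelʳ-≤ E (length rivals) (length others) (begin
    length rivals + E                                ≡⟨ cong (_+ E) (countᵇ≡∑𝟙 rival (allFin m)) ⟩
    ∑ (allFin m) (λ g → 𝟙 (rival g)) + E             ≡⟨ ∑-+ (allFin m) (λ g → 𝟙 (rival g)) is-e ⟨
    ∑ (allFin m) (λ g → 𝟙 (rival g) + is-e g)        ≤⟨ ∑-mono-≤ (allFin m) (λ g _ → rival-or-e⇒covers-t′ g) ⟩
    ∑ (allFin m) (λ g → 𝟙 (covers C g t′))           ≡⟨ countᵇ≡∑𝟙 (λ g → covers C g t′) (allFin m) ⟨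
    s C t′                                           ≤⟨ s[t′]≤s[t] ⟩
    s C t                                            ≡⟨ countᵇ≡∑𝟙 (λ g → covers C g t) (allFin m) ⟩
    ∑ (allFin m) (λ g → 𝟙 (covers C g t))            ≤⟨ ∑-mono-≤ (allFin m) (λ g _ → covers-t⇒other-or-e g) ⟩
    ∑ (allFin m) (λ g → 𝟙 (other g) + is-e g)        ≡⟨ ∑-+ (allFin m) (λ g → 𝟙 (other g)) is-e ⟩
    ∑ (allFin m) (λ g → 𝟙 (other g)) + E             ≡⟨ cong (_+ E) (countᵇ≡∑𝟙 other (allFin m)) ⟨
    length others + E                                ∎)
    where
    open ≤-Reasoning
    E : ℕ
    E = ∑ (allFin m) is-e

  private
    t′-elsewhere : Fin m → (Fin m → Fin N) → Bool
    t′-elsewhere g r = t→e r ∧ chooses C r t′ g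

    fallback : Fin m → (Fin m → Fin N) → Bool
    fallback h r = (t→e r ∧ t′→e r) ∧ chooses (withdraw e C) r t h

  t′-lost≤∑rivals : countᵇ (λ r → t→e r ∧ not (t′→e r)) L ≤ ∑ rivals (λ g → countᵇ (t′-elsewhere g) L)
  t′-lost≤∑rivals = countᵇ-≤-∑ _ t′-elsewhere L rivals witness
    where
    witness : ∀ r → r ∈ L → T (t→e r ∧ not (t′→e r)) → Σ (Fin m) (λ g → g ∈ rivals × T (t′-elsewhere g r))
    witness r r∈ lost with to (T-∧ {t→e r}) lost | chooses-exists C r t′∈e
    ... | t→e-r , ¬t′→e-r | g , t′→g =
      g , ∈-filter⁺ (T? ∘ rival) (∈-allFin g) (from (T-rival g) (t′∈g , t∉g)) , from (T-∧ {t→e r}) (t→e-r , t′→g)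
      where
      t′∈g : t′ ∈ₛ C g
      t′∈g = proj₁ (to (T-chooses C r t′ g) t′→g)
      t∉g : ¬ t ∈ₛ C g
      t∉g t∈g = to T-not ¬t′→e-r (subst (λ x → T (chooses C r t′ x)) (sym e≡g) t′→g)
        where
        e≡g : e ≡ g
        e≡g = ∈-legal⁻ r∈ (F.≤-antisym (proj₂ (to (T-chooses C r t e) t→e-r) g t∈g)
                                       (proj₂ (to (T-chooses C r t′ g) t′→g) e t′∈e))

  module _ {g h : Fin m} (g∈ : g ∈ rivals) (h∈ : h ∈ others) where

    private
      t′∈g : t′ ∈ₛ C g
      t′∈g = proj₁ (to (T-rival g) (proj₂ (∈-filter⁻ (T? ∘ rival) {xs = allFin m} g∈)))
      t∉g : ¬ t ∈ₛ C g
      t∉g = proj₂ (to (T-rival g) (proj₂ (∈-filter⁻ (T? ∘ rival) {xs = allFin m} g∈)))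
      h≢e×t∈h : h ≢ e × t ∈ₛ C h
      h≢e×t∈h = to ∈-withdraw (to T-⌊⌋ (proj₂ (∈-filter⁻ (T? ∘ other) {xs = allFin m} h∈)))
      h≢e : h ≢ e
      h≢e = proj₁ h≢e×t∈h
      t∈h : t ∈ₛ C h
      t∈h = proj₂ h≢e×t∈h
      e≢g : e ≢ g
      e≢g refl = t∉g t∈e
      g≢h : g ≢ h
      g≢h refl = t∉g t∈h

      ρ : Fin m → Fin m
      ρ = cycle e g h ⟨$⟩ʳ_

      t∈ρ : ∀ z {y} → ρ z ≡ y → t ∈ₛ C y → t ∈ₛ C (ρ z)
      t∈ρ z ρz≡y = subst (λ x → t ∈ₛ C x) (sym ρz≡y)

      ρ-others : ∀ {z} → z ≢ e → t ∈ₛ C z → t ∈ₛ C (ρ z)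
      ρ-others {z} z≢e t∈z with cycle-≢a e≢g g≢h h≢e z≢e
      ... | inj₁ (inj₁ ρz≡h) = t∈ρ z ρz≡h t∈h
      ... | inj₁ (inj₂ ρz≡e) = t∈ρ z ρz≡e t∈e
      ... | inj₂ ρz≡z        = t∈ρ z ρz≡z t∈z

      ρ-covering : ∀ z → t ∈ₛ C z ⊎ t′ ∈ₛ C z → t ∈ₛ C (ρ z) ⊎ t′ ∈ₛ C (ρ z)
      ρ-covering z = by-cases (z F.≟ e)
        where
        by-cases : Dec (z ≡ e) → t ∈ₛ C z ⊎ t′ ∈ₛ C z → t ∈ₛ C (ρ z) ⊎ t′ ∈ₛ C (ρ z)
        by-cases (yes refl) _          = inj₂ (subst (λ x → t′ ∈ₛ C x) (sym (cycle-a e≢g g≢h h≢e)) t′∈g)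
        by-cases (no z≢e)   (inj₁ t∈z)  = inj₁ (ρ-others z≢e t∈z)
        by-cases (no z≢e)   (inj₂ t′∈z) with cycle-≢a e≢g g≢h h≢e z≢e
        ... | inj₁ (inj₁ ρz≡h) = inj₁ (t∈ρ z ρz≡h t∈h)
        ... | inj₁ (inj₂ ρz≡e) = inj₁ (t∈ρ z ρz≡e t∈e)
        ... | inj₂ ρz≡z        = inj₂ (subst (λ x → t′ ∈ₛ C x) (sym ρz≡z) t′∈z)

      rotated : ∀ r → T (t′-elsewhere g r) → T (fallback h (r ∘ ρ))
      rotated r t→e∧t′→g =
        from (T-∧ {t→e (r ∘ ρ) ∧ t′→e (r ∘ ρ)})
          (from (T-∧ {t→e (r ∘ ρ)}) (chooses-e-after t∈e inj₁ , chooses-e-after t′∈e inj₂) , h-fallback)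
        where
        t→e-r : T (t→e r)
        t→e-r = proj₁ (to (T-∧ {t→e r}) t→e∧t′→g)
        t′→g-r : T (chooses C r t′ g)
        t′→g-r = proj₂ (to (T-∧ {t→e r}) t→e∧t′→g)
        e-min : ∀ z → t ∈ₛ C z → r e F.≤ r z
        e-min = proj₂ (to (T-chooses C r t e) t→e-r)
        g-min : ∀ z → t′ ∈ₛ C z → r g F.≤ r z
        g-min = proj₂ (to (T-chooses C r t′ g) t′→g-r)
        ρe≡g : ρ e ≡ g
        ρe≡g = cycle-a e≢g g≢h h≢e
        ρh≡e : ρ h ≡ e
        ρh≡e = cycle-c e≢g g≢h h≢e
        g-least : ∀ z → t ∈ₛ C z ⊎ t′ ∈ₛ C z → r g F.≤ r z
        g-least z (inj₁ t∈z)  = F.≤-trans (g-min e t′∈e) (e-min z t∈z)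
        g-least z (inj₂ t′∈z) = g-min z t′∈z
        chooses-e-after : ∀ {u} → u ∈ₛ C e → (∀ {z} → u ∈ₛ C z → t ∈ₛ C z ⊎ t′ ∈ₛ C z) → T (chooses C (r ∘ ρ) u e)
        chooses-e-after {u} u∈e u-covering = from (T-chooses C (r ∘ ρ) u e) (u∈e , λ z u∈z →
          subst (λ x → r x F.≤ r (ρ z)) (sym ρe≡g) (g-least (ρ z) (ρ-covering z (u-covering u∈z))))
        h-fallback : T (chooses (withdraw e C) (r ∘ ρ) t h)
        h-fallback = from (T-chooses (withdraw e C) (r ∘ ρ) t h) (from (∈-withdraw {C = C}) h≢e×t∈h , λ z t∈z′ →
          let z≢e , t∈z = to (∈-withdraw {C = C} {e′ = z}) t∈z′ in
          subst (λ x → r x F.≤ r (ρ z)) (sym ρh≡e) (e-min (ρ z) (ρ-others z≢e t∈z)))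

      fallback-resp : Respects≗ (fallback h)
      fallback-resp r≗r′ = cong₂ _∧_ (cong₂ _∧_ (chooses-resp C t e r≗r′) (chooses-resp C t′ e r≗r′))
                                     (chooses-resp (withdraw e C) t h r≗r′)

    rotate : countᵇ (t′-elsewhere g) L ≤ countᵇ (fallback h) L
    rotate = begin
      countᵇ (t′-elsewhere g) L              ≤⟨ countᵇ-mono _ _ L (λ r _ → rotated r) ⟩
      countᵇ (λ r → fallback h (r ∘ ρ)) L    ≤⟨ countᵇ-legal-∘-≤ (cycle e g h) (fallback h) fallback-resp ⟩
      countᵇ (fallback h) L                  ∎
      where open ≤-Reasoning

  ∑fallbacks≤t′-kept : ∑ others (λ h → countᵇ (fallback h) L) ≤ countᵇ (λ r → t→e r ∧ t′→e r) L
  ∑fallbacks≤t′-kept = ∑-countᵇ-≤ _ fallback L others (AllPairs.filter⁺ _ (Unique.allFin⁺ m)) at-most-one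
    (λ r h → proj₁ ∘ to (T-∧ {t→e r ∧ t′→e r}))
    where
    at-most-one : ∀ r → r ∈ L → ∀ {h h′} → h ≢ h′ → T (fallback h r) → T (fallback h′ r) → ⊥
    at-most-one r r∈ {h} {h′} h≢h′ fb fb′ = h≢h′ (chooses-unique (withdraw e C) (∈-legal⁻ r∈)
      (proj₂ (to (T-∧ {t→e r ∧ t′→e r}) fb)) (proj₂ (to (T-∧ {t→e r ∧ t′→e r}) fb′)))

  t′-lost≤t′-kept : countᵇ (λ r → t→e r ∧ not (t′→e r)) L ≤ countᵇ (λ r → t→e r ∧ t′→e r) L
  t′-lost≤t′-kept = begin
    countᵇ (λ r → t→e r ∧ not (t′→e r)) L       ≤⟨ t′-lost≤∑rivals ⟩
    ∑ rivals (λ g → countᵇ (t′-elsewhere g) L)  ≤⟨ ∑-longer-≥ rivals others _ _ rivals≤others rotate ⟩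
    ∑ others (λ h → countᵇ (fallback h) L)      ≤⟨ ∑fallbacks≤t′-kept ⟩
    countᵇ (λ r → t→e r ∧ t′→e r) L             ∎
    where open ≤-Reasoning

  follows-≥-half : 2 * countᵇ (λ r → chooses C r t e ∧ not (chooses C r t′ e)) (legal m N)
                   ≤ countᵇ (λ r → chooses C r t e) (legal m N)
  follows-≥-half = begin
    2 * lost         ≡⟨ cong (lost +_) (+-identityʳ lost) ⟩
    lost + lost      ≤⟨ +-monoˡ-≤ lost t′-lost≤t′-kept ⟩
    kept + lost      ≡⟨ countᵇ-split t→e t′→e L ⟨
    countᵇ t→e L     ∎
    where
    open ≤-Reasoning
    lost kept : ℕ
    lost = countᵇ (λ r → t→e r ∧ not (t′→e r)) L
    kept = countᵇ (λ r → t→e r ∧ t′→e r) L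

AllPairs-++⁻ : {A : Set} {R : A → A → Set} (xs : List A) {ys : List A} → AllPairs R (xs ++ ys) →
               ∀ {x y} → x ∈ xs → y ∈ ys → R x y
AllPairs-++⁻ (x ∷ xs) (Rx ∷ _)    (here refl) y∈ = All.lookup Rx (∈-++⁺ʳ xs y∈)
AllPairs-++⁻ (x ∷ xs) (_  ∷ rest) (there x∈)  y∈ = AllPairs-++⁻ xs rest x∈ y∈

AllPairs-take-drop : {A : Set} {R : A → A → Set} (n : ℕ) {xs : List A} → AllPairs R xs →
                     ∀ {x y} → x ∈ take n xs → y ∈ drop n xs → R x y
AllPairs-take-drop n {xs} apart = AllPairs-++⁻ (take n xs) (subst (AllPairs _) (sym (take++drop≡id n xs)) apart)

∈-drop⁻ : {A : Set} (n : ℕ) {xs : List A} {x : A} → x ∈ drop n xs → x ∈ xs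
∈-drop⁻ n {xs} x∈ = subst (_ ∈_) (take++drop≡id n xs) (∈-++⁺ʳ (take n xs) x∈)

∈-take⁻ : {A : Set} (n : ℕ) {xs : List A} {x : A} → x ∈ take n xs → x ∈ xs
∈-take⁻ n {xs} x∈ = subst (_ ∈_) (take++drop≡id n xs) (∈-++⁺ˡ x∈)

length≤n+length-drop : {A : Set} (n : ℕ) (xs : List A) → length xs ≤ n + length (drop n xs)
length≤n+length-drop n xs = begin
  length xs                                   ≡⟨ cong length (take++drop≡id n xs) ⟨
  length (take n xs ++ drop n xs)             ≡⟨ length-++ (take n xs) ⟩
  length (take n xs) + length (drop n xs)     ≤⟨ +-monoˡ-≤ _ (≤-trans (≤-reflexive (length-take n xs)) (m⊓n≤m n _)) ⟩
  n + length (drop n xs)                      ∎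
  where open ≤-Reasoning

-- allFin (suc k) computes to zero ∷ tabulate suc.
countᵇ-∈?-∷ : ∀ {k} b (p : Subset k) →
  countᵇ (λ x → ⌊ x ∈? (b ∷ p) ⌋) (tabulate F.suc) ≡ countᵇ (λ x → ⌊ x ∈? p ⌋) (allFin k)
countᵇ-∈?-∷ {k} b p = begin
  countᵇ ∈b∷p (tabulate F.suc)                 ≡⟨ cong (countᵇ ∈b∷p) (map-tabulate (λ x → x) F.suc) ⟨
  countᵇ ∈b∷p (map F.suc (allFin k))           ≡⟨ countᵇ-map ∈b∷p F.suc (allFin k) ⟩
  countᵇ (λ x → ∈b∷p (F.suc x)) (allFin k)     ≡⟨ countᵇ-cong (allFin k) (λ x → ⌊⌋-map′ _ _ (x ∈? p)) ⟩
  countᵇ (λ x → ⌊ x ∈? p ⌋) (allFin k)         ∎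
  where
  open ≡-Reasoning
  ∈b∷p : Fin (suc k) → Bool
  ∈b∷p x = ⌊ x ∈? (b ∷ p) ⌋

∣p∣≡countᵇ : ∀ {k} (p : Subset k) → ∣ p ∣ ≡ countᵇ (λ x → ⌊ x ∈? p ⌋) (allFin k)
∣p∣≡countᵇ []            = refl
∣p∣≡countᵇ (inside  ∷ p) = cong suc (trans (∣p∣≡countᵇ p) (sym (countᵇ-∈?-∷ inside p)))
∣p∣≡countᵇ (outside ∷ p) = trans (∣p∣≡countᵇ p) (sym (countᵇ-∈?-∷ outside p))

∣p∣≤length : ∀ {k} (p : Subset k) (xs : List (Fin k)) → (∀ x → x ∈ₛ p → x ∈ xs) → ∣ p ∣ ≤ length xs
∣p∣≤length {k} p xs p⊆xs = begin
  ∣ p ∣                                  ≡⟨ ∣p∣≡countᵇ p ⟩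
  countᵇ (λ x → ⌊ x ∈? p ⌋) (allFin k)   ≤⟨ Unique⇒length-≤ F._≟_ (Unique.filter⁺ _ (Unique.allFin⁺ k)) ∈-xs ⟩
  length xs                              ∎
  where
  open ≤-Reasoning
  ∈-xs : ∀ {x} → x ∈ filterᵇ (λ x → ⌊ x ∈? p ⌋) (allFin k) → x ∈ xs
  ∈-xs {x} x∈ = p⊆xs x (toWitness (proj₂ (∈-filter⁻ (T? ∘ (λ x → ⌊ x ∈? p ⌋)) {xs = allFin k} x∈)))

-- Averaging over the elements after t

⌈n/2⌉≤1+⌊n/2⌋ : ∀ n → ⌈ n /2⌉ ≤ suc ⌊ n /2⌋
⌈n/2⌉≤1+⌊n/2⌋ zero          = z≤n
⌈n/2⌉≤1+⌊n/2⌋ (suc zero)    = s≤s z≤n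
⌈n/2⌉≤1+⌊n/2⌋ (suc (suc n)) = s≤s (⌈n/2⌉≤1+⌊n/2⌋ n)

≤⌈/2⌉+⇒≤2*+1 : ∀ c L → c ≤ ⌈ c /2⌉ + L → c ≤ 2 * L + 1
≤⌈/2⌉+⇒≤2*+1 c L c≤ = begin
  c                      ≡⟨ ⌊n/2⌋+⌈n/2⌉≡n c ⟨
  ⌊ c /2⌋ + ⌈ c /2⌉      ≤⟨ +-mono-≤ ⌊c/2⌋≤L (≤-trans (⌈n/2⌉≤1+⌊n/2⌋ c) (s≤s ⌊c/2⌋≤L)) ⟩
  L + suc L              ≡⟨ L+1+L≡2L+1 L ⟩
  2 * L + 1              ∎
  where
  open ≤-Reasoning
  L+1+L≡2L+1 : ∀ L → L + suc L ≡ 2 * L + 1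
  L+1+L≡2L+1 = solve-∀
  ⌊c/2⌋≤L : ⌊ c /2⌋ ≤ L
  ⌊c/2⌋≤L = +-cancelʳ-≤ ⌈ c /2⌉ ⌊ c /2⌋ L (begin
    ⌊ c /2⌋ + ⌈ c /2⌉  ≡⟨ ⌊n/2⌋+⌈n/2⌉≡n c ⟩
    c                  ≤⟨ c≤ ⟩
    ⌈ c /2⌉ + L        ≡⟨ +-comm ⌈ c /2⌉ L ⟩
    L + ⌈ c /2⌉        ∎)

few-hits⇒many-misses : ∀ h x → 8 * suc h ≤ 2 * (h + x) → 3 * (h + x) + 4 ≤ 4 * x
few-hits⇒many-misses h x 8[1+h]≤2[h+x] = begin
  3 * (h + x) + 4  ≡⟨ regroup h x ⟩
  (3 * h + 4) + 3 * x ≤⟨ +-monoˡ-≤ (3 * x) 3h+4≤x ⟩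
  x + 3 * x        ≡⟨⟩
  4 * x            ∎
  where
  open ≤-Reasoning
  regroup : ∀ h x → 3 * (h + x) + 4 ≡ (3 * h + 4) + 3 * x
  regroup = solve-∀
  split : ∀ h → 8 * suc h ≡ 2 * h + 2 * (3 * h + 4)
  split = solve-∀
  3h+4≤x : 3 * h + 4 ≤ x
  3h+4≤x = *-cancelˡ-≤ 2 (+-cancelˡ-≤ (2 * h) _ _ (begin
    2 * h + 2 * (3 * h + 4) ≡⟨ split h ⟨
    8 * suc h               ≤⟨ 8[1+h]≤2[h+x] ⟩
    2 * (h + x)             ≡⟨ *-distribˡ-+ 2 h x ⟩
    2 * h + 2 * x           ∎))

≤-third : ∀ n a b → (3 * n + 4) * b ≤ 2 * (n * (a + b)) → a + b ≤ 3 * a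
≤-third n a b hyp = begin
  a + b      ≤⟨ +-monoʳ-≤ a b≤2a ⟩
  a + 2 * a  ≡⟨⟩
  3 * a      ∎
  where
  open ≤-Reasoning
  lhs : ∀ n b → (3 * n + 4) * b ≡ 2 * (n * b) + (4 + n) * b
  lhs = solve-∀
  rhs : ∀ n a b → 2 * (n * (a + b)) ≡ 2 * (n * b) + n * (2 * a)
  rhs = solve-∀
  b≤2a : b ≤ 2 * a
  b≤2a = *-cancelˡ-≤ (4 + n) (+-cancelˡ-≤ (2 * (n * b)) _ _ (begin
    2 * (n * b) + (4 + n) * b        ≡⟨ lhs n b ⟨
    (3 * n + 4) * b                  ≤⟨ hyp ⟩
    2 * (n * (a + b))                ≡⟨ rhs n a b ⟩
    2 * (n * b) + n * (2 * a)        ≤⟨ +-monoʳ-≤ (2 * (n * b)) (*-monoˡ-≤ (2 * a) (m≤n+m n 4)) ⟩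
    2 * (n * b) + (4 + n) * (2 * a)  ∎))

module _ {k m N : ℕ} (C : Fin m → Subset k) (e : Fin m) {t : Fin k} {post : List (Fin k)}
  (t∈e : t ∈ₛ C e) (post⊆e : All (λ t′ → t′ ∈ₛ C e) post) (post-≤ : All (λ t′ → s C t′ ≤ s C t) post)
  (t∷post-unique : Unique (t ∷ post)) (∣e∣≤ : ∣ C e ∣ ≤ 2 * length post + 1) where

  private
    L : List (Fin m → Fin N)
    L = legal m N

    n : ℕ
    n = length post

    t→e : (Fin m → Fin N) → Bool
    t→e r = chooses C r t e

  defectors-bound : ∀ r → T (t→e r) → ¬ T (chosen C r e) →
                    3 * n + 4 ≤ 4 * countᵇ (λ t′ → not (chooses C r t′ e)) post
  defectors-bound r t→e-r unchosen =
    subst (λ n → 3 * n + 4 ≤ 4 * misses) hits+misses≡n (few-hits⇒many-misses hits misses 8[1+hits]≤2n)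
    where
    →e : Fin k → Bool
    →e u = chooses C r u e
    hits misses : ℕ
    hits = countᵇ →e post
    misses = countᵇ (λ t′ → not (→e t′)) post
    hits+misses≡n : hits + misses ≡ n
    hits+misses≡n = trans (sym (countᵇ-split (λ _ → true) →e post)) (countᵇ-true post)
    1+hits≤all : suc hits ≤ countᵇ →e (allFin k)
    1+hits≤all = subst (_≤ countᵇ →e (allFin k)) (countᵇ-∷ →e post t→e-r)
      (Unique⇒countᵇ-≤ F._≟_ →e t∷post-unique (λ {u} _ → ∈-allFin u))
    8[1+hits]≤2n : 8 * suc hits ≤ 2 * (hits + misses)
    8[1+hits]≤2n = subst (λ n → 8 * suc hits ≤ 2 * n) (sym hits+misses≡n) (begin
      8 * suc hits                   ≤⟨ *-monoʳ-≤ 8 1+hits≤all ⟩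
      8 * countᵇ →e (allFin k)       ≤⟨ ≤-pred (begin-strict
        8 * countᵇ →e (allFin k)       <⟨ ≰⇒> (unchosen ∘ fromWitness) ⟩
        ∣ C e ∣                        ≤⟨ ∣e∣≤ ⟩
        2 * n + 1                      ≡⟨ +-comm (2 * n) 1 ⟩
        suc (2 * n)                    ∎) ⟩
      2 * n                          ∎)
      where open ≤-Reasoning

  private
    defects : Fin k → (Fin m → Fin N) → Bool
    defects t′ r = t→e r ∧ not (chooses C r t′ e)

    unchosen : (Fin m → Fin N) → Bool
    unchosen r = t→e r ∧ not (chosen C r e)

  unchosen-weighted : (3 * n + 4) * countᵇ unchosen L ≤ 2 * (n * countᵇ t→e L)
  unchosen-weighted = begin
    (3 * n + 4) * countᵇ unchosen L                   ≡⟨ cong ((3 * n + 4) *_) (countᵇ≡∑𝟙 unchosen L) ⟩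
    (3 * n + 4) * ∑ L (λ r → 𝟙 (unchosen r))          ≡⟨ ∑-*ˡ L (3 * n + 4) (λ r → 𝟙 (unchosen r)) ⟨
    ∑ L (λ r → (3 * n + 4) * 𝟙 (unchosen r))          ≤⟨ ∑-mono-≤ L (λ r _ → *-𝟙-≤ (3 * n + 4) _ (many-defect r)) ⟩
    ∑ L (λ r → 4 * countᵇ (λ t′ → defects t′ r) post) ≡⟨ ∑-*ˡ L 4 (λ r → countᵇ (λ t′ → defects t′ r) post) ⟩
    4 * ∑ L (λ r → countᵇ (λ t′ → defects t′ r) post) ≡⟨ cong (4 *_) (∑-countᵇ-comm defects L post) ⟩
    4 * ∑ post lost                                   ≡⟨ *-assoc 2 2 (∑ post lost) ⟩
    2 * (2 * ∑ post lost)                             ≡⟨ cong (2 *_) (∑-*ˡ post 2 lost) ⟨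
    2 * ∑ post (λ t′ → 2 * lost t′)                   ≤⟨ *-monoʳ-≤ 2 (∑-mono-≤ post (λ t′ t′∈ →
                                                          follows-≥-half C e t∈e (All.lookup post⊆e t′∈) (All.lookup post-≤ t′∈))) ⟩
    2 * ∑ post (λ _ → countᵇ t→e L)                   ≡⟨ cong (2 *_) (∑-const post (countᵇ t→e L)) ⟩
    2 * (n * countᵇ t→e L)                            ∎
    where
    open ≤-Reasoning
    lost : Fin k → ℕ
    lost t′ = countᵇ (defects t′) L
    many-defect : ∀ r → T (unchosen r) → 3 * n + 4 ≤ 4 * countᵇ (λ t′ → defects t′ r) post
    many-defect r unchosen-r =
      let t→e-r , ¬chosen = to (T-∧ {t→e r}) unchosen-r in
      subst (λ c → 3 * n + 4 ≤ 4 * c)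
        (countᵇ-cong post (λ t′ → cong (_∧ not (chooses C r t′ e)) (sym (to T-≡ t→e-r))))
        (defectors-bound r t→e-r (to T-not ¬chosen))

  chosen-≥-third : countᵇ t→e L ≤ 3 * countᵇ (λ r → t→e r ∧ chosen C r e) L
  chosen-≥-third = subst (_≤ 3 * countᵇ (λ r → t→e r ∧ chosen C r e) L) (sym (countᵇ-split t→e (λ r → chosen C r e) L))
    (≤-third n _ _ (subst (λ c → (3 * n + 4) * countᵇ unchosen L ≤ 2 * (n * c))
                          (countᵇ-split t→e (λ r → chosen C r e) L) unchosen-weighted))

claim5 : (k m N : ℕ) (C : Fin m → Subset k) → (∀ e → Nonempty (C e)) →
    (e : Fin m) (t : Fin k) (ord : List (Fin k)) → Unique ord →
    (∀ x → (x ∈ ord) ⇔ (x ∈ₛ C e)) →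
    Linked (λ a b → s C b ≤ s C a) ord →
    t ∈ take ⌈ ∣ C e ∣ /2⌉ ord →
    countᵇ (λ r → chooses C r t e) (legal m N)
      ≤ 3 * countᵇ (λ r → chooses C r t e ∧ chosen C r e) (legal m N)
claim5 k m N C _ e t ord ord-unique ord⇔e sorted t∈front =
  chosen-≥-third C e (to (ord⇔e t) (∈-take⁻ half t∈front))
    (All.tabulate (λ t′∈ → to (ord⇔e _) (∈-drop⁻ half t′∈)))
    (All.tabulate (AllPairs-take-drop half (Linked⇒AllPairs (λ b≤a c≤b → ≤-trans c≤b b≤a) sorted) t∈front))
    (All.tabulate (AllPairs-take-drop half ord-unique t∈front) ∷ Unique.drop⁺ half ord-unique)
    (≤⌈/2⌉+⇒≤2*+1 ∣ C e ∣ (length (drop half ord))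
      (≤-trans (∣p∣≤length (C e) ord (λ x → from (ord⇔e x))) (length≤n+length-drop half ord)))
  where
  half : ℕ
  half = ⌈ ∣ C e ∣ /2⌉
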